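{- Let $\mathsf{i}:\mathsf{IF}\to\mathsf{MF}$ be the inclusion functor. Then the category $\mathsf{IF_{\Box}}$ of $\Box$-frames and $\Box$-frame morphisms is isomorphic to $\mathsf{Dialg}(\mathsf{i},\mathsf{G})$.
   Context: $\mathsf{MF}$: meet-semilattices with top (viewed as posets) and maps preserving finite meets. An I-frame is a poset $(X,\leq)$ that is an implicative meet-semilattice with top; an I-frame morphism is a finite-meet-preserving map $f$ such that $f(x)\leq' y'$ implies $\exists y\geq x$ with $f(y)=y'$; these form $\mathsf{IF}$. A filter is a non-empty up-closed subset closed under finite meets. $\mathsf{G}:\mathsf{IF}\to\mathsf{MF}$ sends $(X,\leq)$ to the set of its filters ordered by reverse inclusion, with top $\{\top\}$ and meet $a \sqcap b = \{x\wedge y \mid x\in a, y\in b\}$, and sends a morphism $h$ to $a\mapsto h[a]$. For functors $\mathsf{F},\mathsf{H}:\mathsf{C}\to\mathsf{D}$, $\mathsf{Dialg}(\mathsf{F},\mathsf{H})$ has objects $(X,\gamma)$ with $X\in\mathsf{C}$ and $\gamma:\mathsf{F}X\to\mathsf{H}X$ in $\mathsf{D}$, and morphisms $f:X\to X'$ in $\mathsf{C}$ with $\mathsf{H}f\circ\gamma=\gamma'\circ\mathsf{F}f$. A $\Box$-frame is $(X,\leq,R)$ with $(X,\leq)$ an I-frame and $R$ a relation with (B1) $\top Rx$ iff $x=\top$, and $xR\top$ for all $x$; (B2) $xRy\leq z$ implies $xRz$; (B3) $xRy$, $x'Ry'$ imply $(x\wedge x')R(y\wedge y')$; (B4) $(x\wedge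 x')Rz$ implies $\exists y,y'$ with $xRy$, $x'Ry'$, $y\wedge y'=z$. A $\Box$-frame morphism is an I-frame morphism $h$ such that $xRy$ implies $h(x)R'h(y)$ and $h(x)R'y'$ implies $\exists y$ with $xRy$, $h(y)=y'$. -}

module Defs where

open import Data.Product using (Σ; ∃; ∃₂; _×_; _,_; proj₁; proj₂)
open import Relation.Binary.PropositionalEquality using (_≡_; subst)
open import Relation.Binary.Lattice using (IsBoundedMeetSemilattice; Exponential)

_≐_ : {X : Set} → (X → Set) → (X → Set) → Set
P ≐ Q = ∀ x → (P x → Q x) × (Q x → P x)

record IFrame : Set₁ where
  field
    Carrier : Set
    _≤_     : Carrier → Carrier → Set
    _∧_     : Carrier → Carrier → Carrier
    ⊤       : Carrier
    _⇒_     : Carrier → Carrier → Carrier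
    isBoundedMeetSemilattice : IsBoundedMeetSemilattice _≡_ _≤_ _∧_ ⊤
    exponential : Exponential _≤_ _∧_ _⇒_

record IFHom (A B : IFrame) : Set where
  private
    module A = IFrame A
    module B = IFrame B
  field
    fun    : A.Carrier → B.Carrier
    pres-⊤ : fun A.⊤ ≡ B.⊤
    pres-∧ : ∀ x y → fun (x A.∧ y) ≡ (fun x B.∧ fun y)
    back   : ∀ x y' → fun x B.≤ y' → ∃ λ y → (x A.≤ y) × (fun y ≡ y')

-- Filters (elements of G X)

record Filter (A : IFrame) : Set₁ where
  open IFrame A
  field
    mem        : Carrier → Set
    nonempty   : ∃ mem
    upclosed   : ∀ {x y} → mem x → x ≤ y → mem y
    meetclosed : ∀ {x y} → mem x → mem y → mem (x ∧ y)

open Filter public using (mem)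

-- top of G X : the filter {⊤} (as a subset)
topSet : (A : IFrame) → IFrame.Carrier A → Set
topSet A z = z ≡ IFrame.⊤ A

-- meet in G X : a ⊓ b = { x ∧ y | x ∈ a , y ∈ b } (as a subset)
meetSet : (A : IFrame) → Filter A → Filter A → IFrame.Carrier A → Set
meetSet A a b z = ∃₂ λ u v → mem a u × mem b v × (z ≡ IFrame._∧_ A u v)

-- G h applied to a filter: the image h[a] (as a subset)
imageSet : {A B : IFrame} → IFHom A B → Filter A → IFrame.Carrier B → Set
imageSet h a y' = ∃ λ y → mem a y × (IFHom.fun h y ≡ y')

record BoxStr (A : IFrame) : Set₁ where
  open IFrame A
  field
    R   : Carrier → Carrier → Set
    B1a : ∀ x → (R ⊤ x → x ≡ ⊤) × (x ≡ ⊤ → R ⊤ x)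
    B1b : ∀ x → R x ⊤
    B2  : ∀ {x y z} → R x y → y ≤ z → R x z
    B3  : ∀ {x y x' y'} → R x y → R x' y' → R (x ∧ x') (y ∧ y')
    B4  : ∀ {x x' z} → R (x ∧ x') z →
          ∃₂ λ y y' → R x y × R x' y' × ((y ∧ y') ≡ z)

BoxObj : Set₁
BoxObj = Σ IFrame BoxStr

record BoxHom (A B : BoxObj) : Set where
  private
    module RA = BoxStr (proj₂ A)
    module RB = BoxStr (proj₂ B)
  field
    ifhom : IFHom (proj₁ A) (proj₁ B)
  open IFHom ifhom
  field
    R-forth : ∀ {x y} → RA.R x y → RB.R (fun x) (fun y)
    R-back  : ∀ {x y'} → RB.R (fun x) y' → ∃ λ y → RA.R x y × (fun y ≡ y')

-- Dialg(i , G): an I-frame X with an MF-morphism γ : i X → G X,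
-- i.e. a map into filters preserving top and binary meets (equality in
-- G X is equality of filters as subsets).

record DialgStr (A : IFrame) : Set₁ where
  open IFrame A
  field
    γ     : Carrier → Filter A
    pres-⊤ : mem (γ ⊤) ≐ topSet A
    pres-∧ : ∀ x y → mem (γ (x ∧ y)) ≐ meetSet A (γ x) (γ y)

DialgObj : Set₁
DialgObj = Σ IFrame DialgStr

-- morphisms: I-frame morphisms f with G f ∘ γ = γ' ∘ f
record DialgHom (A B : DialgObj) : Set where
  private
    module GA = DialgStr (proj₂ A)
    module GB = DialgStr (proj₂ B)
  field
    ifhom : IFHom (proj₁ A) (proj₁ B)
  open IFHom ifhom
  field
    commute : ∀ x → imageSet ifhom (GA.γ x) ≐ mem (GB.γ (fun x))

-- Equality of morphisms (both categories are concrete: equality of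
-- underlying maps) and of objects (same I-frame, extensionally equal
-- structure).

bfun : ∀ {A B} → BoxHom A B → IFrame.Carrier (proj₁ A) → IFrame.Carrier (proj₁ B)
bfun f = IFHom.fun (BoxHom.ifhom f)

dfun : ∀ {A B} → DialgHom A B → IFrame.Carrier (proj₁ A) → IFrame.Carrier (proj₁ B)
dfun f = IFHom.fun (DialgHom.ifhom f)

BoxStrEq : {A : IFrame} → BoxStr A → BoxStr A → Set
BoxStrEq s t = ∀ x → BoxStr.R s x ≐ BoxStr.R t x

DialgStrEq : {A : IFrame} → DialgStr A → DialgStr A → Set
DialgStrEq s t = ∀ x → mem (DialgStr.γ s x) ≐ mem (DialgStr.γ t x)

_≈Box_ : BoxObj → BoxObj → Set₁
(A , s) ≈Box (B , t) = Σ (A ≡ B) λ p → BoxStrEq (subst BoxStr p s) t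

_≈Dialg_ : DialgObj → DialgObj → Set₁
(A , s) ≈Dialg (B , t) = Σ (A ≡ B) λ p → DialgStrEq (subst DialgStr p s) t

record Functor : Set₁ where
  field
    F₀ : BoxObj → DialgObj
    F₁ : ∀ {A B} → BoxHom A B → DialgHom (F₀ A) (F₀ B)
    F-resp : ∀ {A B} (f g : BoxHom A B) →
             (∀ x → bfun f x ≡ bfun g x) → ∀ x → dfun (F₁ f) x ≡ dfun (F₁ g) x
    F-id : ∀ {A} (f : BoxHom A A) →
           (∀ x → bfun f x ≡ x) → ∀ x → dfun (F₁ f) x ≡ x
    F-∘  : ∀ {A B C} (f : BoxHom A B) (g : BoxHom B C) (h : BoxHom A C) →
           (∀ x → bfun h x ≡ bfun g (bfun f x)) →
           ∀ x → dfun (F₁ h) x ≡ dfun (F₁ g) (dfun (F₁ f) x)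

-- An isomorphism of categories: a functor that is bijective on objects
-- (up to object equality) and bijective on hom-sets (full and faithful).
record IsIsomorphism (F : Functor) : Set₁ where
  open Functor F
  field
    resp-obj : ∀ {A B} → A ≈Box B → F₀ A ≈Dialg F₀ B
    inj-obj  : ∀ {A B} → F₀ A ≈Dialg F₀ B → A ≈Box B
    surj-obj : ∀ D → ∃ λ A → F₀ A ≈Dialg D
    faithful : ∀ {A B} (f g : BoxHom A B) →
               (∀ x → dfun (F₁ f) x ≡ dfun (F₁ g) x) → ∀ x → bfun f x ≡ bfun g x
    full     : ∀ {A B} (k : DialgHom (F₀ A) (F₀ B)) →
               ∃ λ f → ∀ x → dfun (F₁ f) x ≡ dfun k x

-- A □-frame relation R and a meet-preserving map γ into filters determine each
-- other via  y ∈ γ x  ⇔  x R y:  (B1) says γ ⊤ = {⊤}, (B2) and (B1b) with (B3)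
-- on the diagonal say each R x is a filter, and (B3)/(B4) are the two
-- inclusions of γ (x ∧ x') = γ x ⊓ γ x'.  Likewise the two morphism conditions
-- on R are the two inclusions of h[γ x] = γ (h x).  Both translations keep the
-- underlying I-frame and maps, so they form an isomorphism of categories.
module Submission where

open import Defs
open import Data.Product using (Σ; _,_; proj₁; proj₂)
open import Function using (id)
open import Relation.Binary.PropositionalEquality using (_≡_; refl; sym; subst)
open import Relation.Binary.Lattice using (IsBoundedMeetSemilattice; MeetSemilattice)
import Relation.Binary.Lattice.Properties.MeetSemilattice as MeetSemilatticeProperties

module _ (A : IFrame) where
  open IFrame A
  open IsBoundedMeetSemilattice isBoundedMeetSemilattice using (isMeetSemilattice; maximum)

  private
    meetSemilattice : MeetSemilattice _ _ _
    meetSemilattice = record { isMeetSemilattice = isMeetSemilattice }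

  open MeetSemilatticeProperties meetSemilattice using (∧-idempotent)

  relationFilter : BoxStr A → Carrier → Filter A
  relationFilter s x = record
    { mem        = R x
    ; nonempty   = ⊤ , B1b x
    ; upclosed   = B2
    ; meetclosed = λ r r' → subst (λ w → R w _) (∧-idempotent x) (B3 r r')
    }
    where open BoxStr s

  boxStr⇒dialgStr : BoxStr A → DialgStr A
  boxStr⇒dialgStr s = record
    { γ      = relationFilter s
    ; pres-⊤ = B1a
    ; pres-∧ = λ x x' z →
        (λ r → let (y , y' , r₁ , r₂ , y∧y'≡z) = B4 r in y , y' , r₁ , r₂ , sym y∧y'≡z)
      , λ { (y , y' , r₁ , r₂ , refl) → B3 r₁ r₂ }
    }
    where open BoxStr s

  dialgStr⇒boxStr : DialgStr A → BoxStr A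
  dialgStr⇒boxStr d = record
    { R   = λ x → mem (γ x)
    ; B1a = pres-⊤
    ; B1b = λ x → let (w , w∈γx) = Filter.nonempty (γ x) in
                  Filter.upclosed (γ x) w∈γx (maximum w)
    ; B2  = λ {x} → Filter.upclosed (γ x)
    ; B3  = λ {x} {y} {x'} {y'} r r' → proj₂ (pres-∧ x x' (y ∧ y')) (y , y' , r , r' , refl)
    ; B4  = λ {x} {x'} {z} r →
        let (y , y' , r₁ , r₂ , z≡y∧y') = proj₁ (pres-∧ x x' z) r in y , y' , r₁ , r₂ , sym z≡y∧y'
    }
    where open DialgStr d

boxObj⇒dialgObj : BoxObj → DialgObj
boxObj⇒dialgObj (A , s) = A , boxStr⇒dialgStr A s

dialgObj⇒boxObj : DialgObj → BoxObj
dialgObj⇒boxObj (A , d) = A , dialgStr⇒boxStr A d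

boxHom⇒dialgHom : ∀ {A B} → BoxHom A B → DialgHom (boxObj⇒dialgObj A) (boxObj⇒dialgObj B)
boxHom⇒dialgHom f = record
  { ifhom   = ifhom
  ; commute = λ x y' → (λ { (y , r , refl) → R-forth r }) , R-back
  }
  where open BoxHom f

dialgHom⇒boxHom : ∀ {A B} → DialgHom (boxObj⇒dialgObj A) (boxObj⇒dialgObj B) → BoxHom A B
dialgHom⇒boxHom k = record
  { ifhom   = ifhom
  ; R-forth = λ {x} {y} r → proj₁ (commute x _) (y , r , refl)
  ; R-back  = λ {x} → proj₂ (commute x _)
  }
  where open DialgHom k

≈Box⇒≈Dialg : ∀ {A B} → A ≈Box B → boxObj⇒dialgObj A ≈Dialg boxObj⇒dialgObj B
≈Box⇒≈Dialg {_ , _} {_ , _} (refl , s≐t) = refl , s≐t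

≈Dialg⇒≈Box : ∀ {A B} → boxObj⇒dialgObj A ≈Dialg boxObj⇒dialgObj B → A ≈Box B
≈Dialg⇒≈Box {_ , _} {_ , _} (refl , γ≐γ') = refl , γ≐γ'

boxObj⇒dialgObj-dialgObj⇒boxObj : ∀ D → boxObj⇒dialgObj (dialgObj⇒boxObj D) ≈Dialg D
boxObj⇒dialgObj-dialgObj⇒boxObj (_ , _) = refl , λ x y → id , id

boxToDialg : Functor
boxToDialg = record
  { F₀     = boxObj⇒dialgObj
  ; F₁     = boxHom⇒dialgHom
  ; F-resp = λ f g f≗g → f≗g
  ; F-id   = λ f f≗id → f≗id
  ; F-∘    = λ f g h h≗g∘f → h≗g∘f
  }

theorem4p9 : Σ Functor IsIsomorphism
theorem4p9 = boxToDialg , record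
  { resp-obj = λ {A} {B} → ≈Box⇒≈Dialg {A} {B}
  ; inj-obj  = λ {A} {B} → ≈Dialg⇒≈Box {A} {B}
  ; surj-obj = λ D → dialgObj⇒boxObj D , boxObj⇒dialgObj-dialgObj⇒boxObj D
  ; faithful = λ f g f≗g → f≗g
  ; full     = λ k → dialgHom⇒boxHom k , λ x → refl
  }
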